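{- For integers $n\ge k\ge 0$, let $\mathcal{P}_b(n,k)$ be the set of grounded partitions in $\mathcal{P}_{2,b}$ of weight $n$ having exactly $k$ odd parts, and let $\overline{\mathcal{PO}}(n,k)$ be the set of overpartitions of $n$ into odd parts having exactly $k$ parts. Then there is a bijection between $\mathcal{P}_b(n,k)$ and $\overline{\mathcal{PO}}(n,k)$; in particular $|\mathcal{P}_b(n,k)|=|\overline{\mathcal{PO}}(n,k)|$.
   Context: Colours are $a,b,c$ (indexed $c_0=a$, $c_1=b$, $c_2=c$). A grounded partition in $\mathcal{P}_{2,b}$ is a finite (possibly empty) sequence $(\lambda_1,\lambda_2,\dots,\lambda_\ell)$ of positive integers, each carrying a colour in $\{a,b,c\}$, such that, setting $\lambda_0=0$ with colour $b$ (the ground), for every $0\le j<\ell$, if $\lambda_j$ has colour $c_p$ and $\lambda_{j+1}$ has colour $c_r$, then $\lambda_{j+1}-\lambda_j=|2-p-r|$. (Thus the required differences are: $a\to a$: 2, $a\to b$: 1, $a\to c$: 0, $b\to a$: 1, $b\to b$: 0, $b\to c$: 1, $c\to a$: 0, $c\to b$: 1, $c\to c$: 2.) Its weight is $\lambda_1+\cdots+\lambda_\ell$, and its number of odd parts is counted with multiplicity. An overpartition is a partition in which the first occurrence of each distinct part size may or may not be overlined (equivalently, a pair consisting of a partition into distinct parts, the overlined parts, and an ordinary partition); its number of parts counts all parts, overlined or not, and its weight is the sum of all parts. -}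

module Defs where

open import Data.Nat using (ℕ; zero; suc; _+_; _<_; _≥_; _>_; _%_)
open import Data.Product using (_×_; _,_; proj₁)
open import Data.Unit using (⊤)
open import Data.List using (List; []; _∷_; map; length; filter)
open import Data.Nat.ListAction using (sum)
open import Data.List.Relation.Unary.All using (All)
open import Data.List.Relation.Unary.Linked using (Linked)
open import Relation.Binary.PropositionalEquality using (_≡_)
open import Relation.Nullary.Decidable using (Dec)
open import Data.Nat using (_≟_)

data Colour : Set where
  a b c : Colour

index : Colour → ℕ
index a = 0
index b = 1
index c = 2

-- required difference |2 - p - r| between consecutive parts of colours c_p, c_r
gap : Colour → Colour → ℕ
gap a a = 2
gap a b = 1
gap a c = 0
gap b a = 1
gap b b = 0
gap b c = 1
gap c a = 0
gap c b = 1
gap c c = 2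

CPart : Set
CPart = ℕ × Colour

ValidFrom : ℕ → Colour → List CPart → Set
ValidFrom prev pc [] = ⊤
ValidFrom prev pc ((x , col) ∷ rest) =
  (0 < x) × (x ≡ prev + gap pc col) × ValidFrom x col rest

-- grounded partitions in P_{2,b}: ground λ₀ = 0 with colour b
IsGrounded : List CPart → Set
IsGrounded = ValidFrom 0 b

isOdd : ℕ → Set
isOdd m = m % 2 ≡ 1

odd? : (m : ℕ) → Dec (m % 2 ≡ 1)
odd? m = (m % 2) ≟ 1

sizes : List CPart → List ℕ
sizes = map proj₁

oddCount : List ℕ → ℕ
oddCount xs = length (filter odd? xs)

record Pb (n k : ℕ) : Set where
  constructor mkPb
  field
    parts     : List CPart
    .grounded : IsGrounded parts
    .weight   : sum (sizes parts) ≡ n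
    .odds     : oddCount (sizes parts) ≡ k

-- Overpartitions into odd parts, represented canonically as a pair
-- (overlined parts: strictly decreasing list, non-overlined parts: weakly decreasing list).
record POb (n k : ℕ) : Set where
  constructor mkPOb
  field
    overlined  : List ℕ
    ordinary   : List ℕ
    .ovDistinct : Linked _>_ overlined
    .ordSorted  : Linked _≥_ ordinary
    .ovOdd      : All isOdd overlined
    .ordOdd     : All isOdd ordinary
    .weight     : sum overlined + sum ordinary ≡ n
    .count      : length overlined + length ordinary ≡ k

module Submission where

-- In a grounded partition the parts coloured a or c are the odd parts and those coloured b the
-- even ones, and the partition is determined by its word of colours. After the first part this word
-- is a sequence of steps, each either an odd part of equal size and the other colour, or a run of
-- b's followed by an odd part two larger. Reading the steps, a step of the first kind opens a new
-- level, a climb that flips the colour raises the current level by one (paying for its first b), a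
-- climb that keeps the colour becomes an overline flag, and the remaining run lengths become the
-- topmost increments, the last run lowest. This yields k non-decreasing levels d, an overlined one
-- strictly above its predecessor, i.e. an overpartition into the k odd parts 2d + 1. Weight is
-- preserved: a climb adds 2 to each later odd part, and so does its flag or its unit of level to the
-- parts it lifts, while a part b at level ℓ weighs 2(ℓ + 1), as does a unit increment lifting ℓ + 1
-- levels.

open import Defs
open import Data.Bool using (Bool; true; false; not; _xor_)
open import Data.Empty using (⊥-elim)
open import Data.List using (List; []; _∷_; _++_; map; length; replicate; reverse; _ʳ++_)
open import Data.List.Properties
  using (++-identityʳ; filter-accept; filter-reject; length-map; length-reverse; reverse-map; reverse-involutive)
import Data.List.Properties as List
open import Data.List.Relation.Binary.Permutation.Propositional using (↭-sym)
open import Data.List.Relation.Binary.Permutation.Propositional.Properties using (↭-reverse; All-resp-↭)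
open import Data.List.Relation.Unary.All using (All; []; _∷_; universal)
import Data.List.Relation.Unary.All.Properties as All
open import Data.List.Relation.Unary.Linked as Linked using (Linked; []; [-]; _∷_)
import Data.List.Relation.Unary.Linked.Properties as Linked
open import Data.Nat using (ℕ; zero; suc; _+_; _*_; _∸_; _≤_; _<_; _>_; _≥_; z≤n; s≤s; _≤?_; _≟_; ⌊_/2⌋)
open import Data.Nat.ListAction using (sum)
open import Data.Nat.ListAction.Properties using (sum-↭)
open import Data.Nat.Properties
open import Data.Nat.Tactic.RingSolver using (solve-∀)
open import Data.Product using (_×_; _,_; proj₁; proj₂; map₁; map₂)
open import Data.Product.Properties using (≡-dec)
open import Data.Unit using (tt)
open import Data.Vec using (Vec; []; _∷_; toList)
open import Data.Vec.Properties using (length-toList)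
open import Function using (_∘_; flip)
open import Function.Bundles using (_↔_; mk↔ₛ′)
open import Relation.Binary.Definitions using (DecidableEquality)
open import Relation.Binary.PropositionalEquality
open import Relation.Nullary using (¬_; yes; no)
open import Relation.Nullary.Decidable using (recompute)

module _ {A : Set} {R : A → A → Set} where

  Linked-weakenHead : ∀ {x y zs} → (∀ {z} → R y z → R x z) → Linked R (y ∷ zs) → Linked R (x ∷ zs)
  Linked-weakenHead weaken [-]      = [-]
  Linked-weakenHead weaken (r ∷ lk) = weaken r ∷ lk

  Linked-ʳ++ : ∀ {x xs acc} → Linked R (x ∷ xs) → Linked (flip R) (x ∷ acc) → Linked (flip R) (xs ʳ++ x ∷ acc)
  Linked-ʳ++ [-]      lacc = lacc
  Linked-ʳ++ (r ∷ lk) lacc = Linked-ʳ++ lk (r ∷ lacc)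

  Linked-reverse : ∀ {xs} → Linked R xs → Linked (flip R) (reverse xs)
  Linked-reverse {[]}    []  = []
  Linked-reverse {_ ∷ _} lk = Linked-ʳ++ lk [-]

sum-replicate-++ : ∀ m e xs → sum (replicate m e ++ xs) ≡ m * e + sum xs
sum-replicate-++ zero    e xs = refl
sum-replicate-++ (suc m) e xs = trans (cong (e +_) (sum-replicate-++ m e xs)) (sym (+-assoc e (m * e) (sum xs)))

-- Colour words

colour : Bool → Colour
colour false = a
colour true  = c

colours : List CPart → List Colour
colours = map proj₂

partsFrom : ℕ → Colour → List Colour → List CPart
partsFrom v p []      = []
partsFrom v p (x ∷ w) = (gap p x + v , x) ∷ partsFrom (gap p x + v) x w

partsOf : List Colour → List CPart
partsOf = partsFrom 0 b

colours-partsFrom : ∀ v p w → colours (partsFrom v p w) ≡ w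
colours-partsFrom v p []      = refl
colours-partsFrom v p (x ∷ w) = cong (x ∷_) (colours-partsFrom _ x w)

partsFrom-colours : ∀ v p ps → ValidFrom v p ps → partsFrom v p (colours ps) ≡ ps
partsFrom-colours v p []             _                   = refl
partsFrom-colours v p ((x , q) ∷ ps) (_ , x≡v+gap , valid) =
  trans (cong (λ y → (y , q) ∷ partsFrom y q (colours ps)) gap+v≡x)
        (cong ((x , q) ∷_) (partsFrom-colours x q ps valid))
  where
  gap+v≡x : gap p q + v ≡ x
  gap+v≡x = trans (+-comm (gap p q) v) (sym x≡v+gap)

partsFrom-ValidFrom : ∀ {v} p w → 0 < v → ValidFrom v p (partsFrom v p w)
partsFrom-ValidFrom     p []      _   = tt
partsFrom-ValidFrom {v} p (x ∷ w) v>0 = v′>0 , +-comm (gap p x) v , partsFrom-ValidFrom x w v′>0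
  where v′>0 = <-≤-trans v>0 (m≤n+m v (gap p x))

-- A grounded partition cannot start with colour b, as its first part would be 0.
data GroundedWord : List Colour → Set where
  []  : GroundedWord []
  _∷_ : ∀ s w → GroundedWord (colour s ∷ w)

GroundedWord-colours : ∀ ps → IsGrounded ps → GroundedWord (colours ps)
GroundedWord-colours []             _               = []
GroundedWord-colours ((_ , a) ∷ ps) _               = false ∷ colours ps
GroundedWord-colours ((_ , b) ∷ ps) (x>0 , x≡0 , _) = ⊥-elim (<-irrefl (sym x≡0) x>0)
GroundedWord-colours ((_ , c) ∷ ps) _               = true ∷ colours ps

partsOf-grounded : ∀ {w} → GroundedWord w → IsGrounded (partsOf w)
partsOf-grounded []          = tt
partsOf-grounded (false ∷ w) = s≤s z≤n , refl , partsFrom-ValidFrom a w (s≤s z≤n)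
partsOf-grounded (true ∷ w)  = s≤s z≤n , refl , partsFrom-ValidFrom c w (s≤s z≤n)

-- Steps

bit : Bool → ℕ
bit false = 0
bit true  = 1

-- After an odd part of colour `colour s`, `same` is an odd part of equal size and the other colour,
-- and `climb o β` is `bit o + β` parts of colour b followed by an odd part two larger, whose colour
-- is flipped iff o. Every continuation of a grounded word is described by exactly one step.
data Step : Set where
  same  : Step
  climb : Bool → ℕ → Step

bs : ℕ → List Colour
bs m = replicate m b

word : Bool → List Step → ℕ → List Colour
word s []              t = bs t
word s (same ∷ σ)      t = colour (not s) ∷ word (not s) σ t
word s (climb o β ∷ σ) t = bs (bit o + β) ++ colour (o xor s) ∷ word (o xor s) σ t

mutual
  steps : Bool → List Colour → List Step × ℕ
  steps s     []      = [] , 0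
  steps s     (b ∷ w) = stepsAfterRun s 0 w
  steps false (a ∷ w) = map₁ (climb false 0 ∷_) (steps false w)
  steps false (c ∷ w) = map₁ (same ∷_) (steps true w)
  steps true  (a ∷ w) = map₁ (same ∷_) (steps false w)
  steps true  (c ∷ w) = map₁ (climb false 0 ∷_) (steps true w)

  -- `stepsAfterRun s m w` reads w after m + 1 parts of colour b.
  stepsAfterRun : Bool → ℕ → List Colour → List Step × ℕ
  stepsAfterRun s     m []      = [] , suc m
  stepsAfterRun s     m (b ∷ w) = stepsAfterRun s (suc m) w
  stepsAfterRun false m (a ∷ w) = map₁ (climb false (suc m) ∷_) (steps false w)
  stepsAfterRun false m (c ∷ w) = map₁ (climb true m ∷_) (steps true w)
  stepsAfterRun true  m (a ∷ w) = map₁ (climb true m ∷_) (steps false w)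
  stepsAfterRun true  m (c ∷ w) = map₁ (climb false (suc m) ∷_) (steps true w)

bs-suc : ∀ m w → bs (suc m) ++ w ≡ bs m ++ b ∷ w
bs-suc zero    w = refl
bs-suc (suc m) w = cong (b ∷_) (bs-suc m w)

mutual
  word-steps : ∀ s w → word s (proj₁ (steps s w)) (proj₂ (steps s w)) ≡ w
  word-steps s     []      = refl
  word-steps s     (b ∷ w) = word-stepsAfterRun s 0 w
  word-steps false (a ∷ w) = cong (a ∷_) (word-steps false w)
  word-steps false (c ∷ w) = cong (c ∷_) (word-steps true w)
  word-steps true  (a ∷ w) = cong (a ∷_) (word-steps false w)
  word-steps true  (c ∷ w) = cong (c ∷_) (word-steps true w)

  word-stepsAfterRun : ∀ s m w →
    word s (proj₁ (stepsAfterRun s m w)) (proj₂ (stepsAfterRun s m w)) ≡ bs (suc m) ++ w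
  word-stepsAfterRun s     m []      = sym (++-identityʳ (bs (suc m)))
  word-stepsAfterRun s     m (b ∷ w) = trans (word-stepsAfterRun s (suc m) w) (bs-suc (suc m) w)
  word-stepsAfterRun false m (a ∷ w) = cong (λ w′ → bs (suc m) ++ a ∷ w′) (word-steps false w)
  word-stepsAfterRun false m (c ∷ w) = cong (λ w′ → bs (suc m) ++ c ∷ w′) (word-steps true w)
  word-stepsAfterRun true  m (a ∷ w) = cong (λ w′ → bs (suc m) ++ a ∷ w′) (word-steps false w)
  word-stepsAfterRun true  m (c ∷ w) = cong (λ w′ → bs (suc m) ++ c ∷ w′) (word-steps true w)

stepsAfterRun-bs : ∀ s m n w → stepsAfterRun s m (bs n ++ w) ≡ stepsAfterRun s (m + n) w
stepsAfterRun-bs s m zero    w = cong (λ k → stepsAfterRun s k w) (sym (+-identityʳ m))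
stepsAfterRun-bs s m (suc n) w =
  trans (stepsAfterRun-bs s (suc m) n w) (cong (λ k → stepsAfterRun s k w) (sym (+-suc m n)))

steps-climb : ∀ s o β w →
  steps s (bs (bit o + β) ++ colour (o xor s) ∷ w) ≡ map₁ (climb o β ∷_) (steps (o xor s) w)
steps-climb false false zero    w = refl
steps-climb true  false zero    w = refl
steps-climb false false (suc β) w = stepsAfterRun-bs false 0 β (a ∷ w)
steps-climb true  false (suc β) w = stepsAfterRun-bs true 0 β (c ∷ w)
steps-climb false true  β       w = stepsAfterRun-bs false 0 β (c ∷ w)
steps-climb true  true  β       w = stepsAfterRun-bs true 0 β (a ∷ w)

steps-word : ∀ s σ t → steps s (word s σ t) ≡ (σ , t)
steps-word s     []              zero    = refl
steps-word s     []              (suc t) =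
  trans (cong (stepsAfterRun s 0) (sym (++-identityʳ (bs t)))) (stepsAfterRun-bs s 0 t [])
steps-word false (same ∷ σ)      t = cong (map₁ (same ∷_)) (steps-word true σ t)
steps-word true  (same ∷ σ)      t = cong (map₁ (same ∷_)) (steps-word false σ t)
steps-word s     (climb o β ∷ σ) t =
  trans (steps-climb s o β (word (o xor s) σ t)) (cong (map₁ (climb o β ∷_)) (steps-word (o xor s) σ t))

oddPart : ℕ → ℕ
oddPart ℓ = suc (ℓ * 2)

oddPart-isOdd : ∀ ℓ → isOdd (oddPart ℓ)
oddPart-isOdd zero    = refl
oddPart-isOdd (suc ℓ) = oddPart-isOdd ℓ

suc-oddPart-¬isOdd : ∀ ℓ → ¬ isOdd (suc (oddPart ℓ))
suc-oddPart-¬isOdd zero    ()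
suc-oddPart-¬isOdd (suc ℓ) = suc-oddPart-¬isOdd ℓ

-- Half the amount by which the weight of the parts after an odd part 2ℓ + 1 exceeds that of as
-- many odd parts 2ℓ + 1 and no part b.
excess : ℕ → List Step → ℕ → ℕ
excess ℓ []              t = suc ℓ * t
excess ℓ (same ∷ σ)      t = excess ℓ σ t
excess ℓ (climb o β ∷ σ) t = suc (length σ) + suc ℓ * (bit o + β) + excess (suc ℓ) σ t

sizes-partsOf : ∀ s w → sizes (partsOf (colour s ∷ w)) ≡ 1 ∷ sizes (partsFrom 1 (colour s) w)
sizes-partsOf false w = refl
sizes-partsOf true  w = refl

sizes-same : ∀ v s w →
  sizes (partsFrom v (colour s) (colour (not s) ∷ w)) ≡ v ∷ sizes (partsFrom v (colour (not s)) w)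
sizes-same v false w = refl
sizes-same v true  w = refl

sizes-odd-b : ∀ v s w → sizes (partsFrom v (colour s) (b ∷ w)) ≡ suc v ∷ sizes (partsFrom (suc v) b w)
sizes-odd-b v false w = refl
sizes-odd-b v true  w = refl

sizes-b-odd : ∀ v s w → sizes (partsFrom v b (colour s ∷ w)) ≡ suc v ∷ sizes (partsFrom (suc v) (colour s) w)
sizes-b-odd v false w = refl
sizes-b-odd v true  w = refl

sizes-bs : ∀ v m w → sizes (partsFrom v b (bs m ++ w)) ≡ replicate m v ++ sizes (partsFrom v b w)
sizes-bs v zero    w = refl
sizes-bs v (suc m) w = cong (v ∷_) (sizes-bs v m w)

sizes-bs-end : ∀ v m → sizes (partsFrom v b (bs m)) ≡ replicate m v
sizes-bs-end v zero    = refl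
sizes-bs-end v (suc m) = cong (v ∷_) (sizes-bs-end v m)

sizes-run : ∀ v s s′ m w →
  sizes (partsFrom v (colour s) (bs (suc m) ++ colour s′ ∷ w))
    ≡ replicate (suc m) (suc v) ++ suc (suc v) ∷ sizes (partsFrom (suc (suc v)) (colour s′) w)
sizes-run v s s′ m w = begin
  sizes (partsFrom v (colour s) (b ∷ bs m ++ colour s′ ∷ w))
    ≡⟨ sizes-odd-b v s (bs m ++ colour s′ ∷ w) ⟩
  suc v ∷ sizes (partsFrom (suc v) b (bs m ++ colour s′ ∷ w))
    ≡⟨ cong (suc v ∷_) (sizes-bs (suc v) m (colour s′ ∷ w)) ⟩
  suc v ∷ replicate m (suc v) ++ sizes (partsFrom (suc v) b (colour s′ ∷ w))
    ≡⟨ cong (λ xs → suc v ∷ replicate m (suc v) ++ xs) (sizes-b-odd (suc v) s′ w) ⟩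
  suc v ∷ replicate m (suc v) ++ suc (suc v) ∷ sizes (partsFrom (suc (suc v)) (colour s′) w) ∎
  where open ≡-Reasoning

sizes-climb : ∀ v s o β w →
  sizes (partsFrom v (colour s) (bs (bit o + β) ++ colour (o xor s) ∷ w))
    ≡ replicate (bit o + β) (suc v) ++ suc (suc v) ∷ sizes (partsFrom (suc (suc v)) (colour (o xor s)) w)
sizes-climb v false false zero    w = refl
sizes-climb v true  false zero    w = refl
sizes-climb v s     false (suc β) w = sizes-run v s s β w
sizes-climb v s     true  β       w = sizes-run v s (not s) β w

sizes-end : ∀ v s t → sizes (partsFrom v (colour s) (bs t)) ≡ replicate t (suc v)
sizes-end v s zero    = refl
sizes-end v s (suc t) = trans (sizes-odd-b v s (bs t)) (cong (suc v ∷_) (sizes-bs-end (suc v) t))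

oddCount-odd : ∀ x xs → isOdd x → oddCount (x ∷ xs) ≡ suc (oddCount xs)
oddCount-odd x xs p = cong length (filter-accept odd? {x} {xs} p)

oddCount-even : ∀ x xs → ¬ isOdd x → oddCount (x ∷ xs) ≡ oddCount xs
oddCount-even x xs ¬p = cong length (filter-reject odd? {x} {xs} ¬p)

oddCount-replicate-even-++ : ∀ ℓ m xs → oddCount (replicate m (suc (oddPart ℓ)) ++ xs) ≡ oddCount xs
oddCount-replicate-even-++ ℓ zero    xs = refl
oddCount-replicate-even-++ ℓ (suc m) xs =
  trans (oddCount-even (suc (oddPart ℓ)) (replicate m (suc (oddPart ℓ)) ++ xs) (suc-oddPart-¬isOdd ℓ))
        (oddCount-replicate-even-++ ℓ m xs)

oddCount-word : ∀ ℓ s σ t → oddCount (sizes (partsFrom (oddPart ℓ) (colour s) (word s σ t))) ≡ length σ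
oddCount-word ℓ s [] t =
  trans (cong oddCount (trans (sizes-end (oddPart ℓ) s t) (sym (++-identityʳ _)))) (oddCount-replicate-even-++ ℓ t [])
oddCount-word ℓ s (same ∷ σ) t =
  trans (cong oddCount (sizes-same (oddPart ℓ) s (word (not s) σ t)))
        (trans (oddCount-odd (oddPart ℓ) _ (oddPart-isOdd ℓ)) (cong suc (oddCount-word ℓ (not s) σ t)))
oddCount-word ℓ s (climb o β ∷ σ) t =
  trans (cong oddCount (sizes-climb (oddPart ℓ) s o β (word (o xor s) σ t)))
        (trans (oddCount-replicate-even-++ ℓ (bit o + β) _)
               (trans (oddCount-odd (oddPart (suc ℓ)) _ (oddPart-isOdd (suc ℓ)))
                      (cong suc (oddCount-word (suc ℓ) (o xor s) σ t))))

sum-word : ∀ ℓ s σ t →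
  sum (sizes (partsFrom (oddPart ℓ) (colour s) (word s σ t))) ≡ oddPart ℓ * length σ + 2 * excess ℓ σ t
sum-word ℓ s [] t =
  trans (cong sum (trans (sizes-end (oddPart ℓ) s t) (sym (++-identityʳ _))))
        (trans (sum-replicate-++ t (suc (oddPart ℓ)) []) (arith ℓ t))
  where
  arith : ∀ ℓ t → t * suc (suc (ℓ * 2)) + 0 ≡ suc (ℓ * 2) * 0 + 2 * (suc ℓ * t)
  arith = solve-∀
sum-word ℓ s (same ∷ σ) t =
  trans (cong sum (sizes-same (oddPart ℓ) s (word (not s) σ t)))
        (trans (cong (oddPart ℓ +_) (sum-word ℓ (not s) σ t)) (arith ℓ (length σ) (excess ℓ σ t)))
  where
  arith : ∀ ℓ l e → suc (ℓ * 2) + (suc (ℓ * 2) * l + 2 * e) ≡ suc (ℓ * 2) * suc l + 2 * e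
  arith = solve-∀
sum-word ℓ s (climb o β ∷ σ) t =
  trans (cong sum (sizes-climb (oddPart ℓ) s o β (word (o xor s) σ t)))
        (trans (sum-replicate-++ (bit o + β) (suc (oddPart ℓ)) _)
               (trans (cong (λ x → (bit o + β) * suc (oddPart ℓ) + (oddPart (suc ℓ) + x)) (sum-word (suc ℓ) (o xor s) σ t))
                      (arith ℓ (bit o + β) (length σ) (excess (suc ℓ) σ t))))
  where
  arith : ∀ ℓ r l e → r * suc (suc (ℓ * 2)) + (suc (suc (suc (ℓ * 2))) + (suc (suc (suc (ℓ * 2))) * l + 2 * e))
                    ≡ suc (ℓ * 2) * suc l + 2 * (suc l + suc ℓ * r + e)
  arith = solve-∀

-- From steps to level increments

-- The steps after n climbs whose runs of b's are still pending: their β's (latest first), the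
-- steps and the final run of b's.
Climbs : ℕ → Set
Climbs n = Vec ℕ n × List Step × ℕ

-- The overline flags, lowest level and increments of a non-decreasing sequence of flagged levels.
Increments : Set
Increments = List Bool × ℕ × List ℕ

Balanced : Increments → Set
Balanced (fs , _ , xs) = length fs ≡ length xs

weighted : List ℕ → ℕ
weighted []       = 0
weighted (x ∷ xs) = x * suc (length xs) + weighted xs

incrementsWeight : Increments → ℕ
incrementsWeight (fs , h , xs) = weighted (map bit fs) + weighted (h ∷ xs)

openLevel : Increments → Increments
openLevel (fs , h , xs) = false ∷ fs , 0 , h ∷ xs

overline : Increments → Increments
overline (fs , h , xs) = true ∷ fs , h , xs

raiseLevel : Increments → Increments
raiseLevel (fs , h , xs) = false ∷ fs , suc h , xs

toIncrements : ∀ {n} → Vec ℕ n → List Step → ℕ → Increments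
toIncrements βs []                  t = [] , t , toList βs
toIncrements βs (same ∷ σ)          t = openLevel (toIncrements βs σ t)
toIncrements βs (climb false β ∷ σ) t = overline (toIncrements (β ∷ βs) σ t)
toIncrements βs (climb true β ∷ σ)  t = raiseLevel (toIncrements (β ∷ βs) σ t)

fill : ∀ {n} → List ℕ → Vec ℕ n
fill {zero}  _        = []
fill {suc n} []       = 0 ∷ fill []
fill {suc n} (x ∷ xs) = x ∷ fill xs

fill-toList : ∀ {n} (v : Vec ℕ n) → fill (toList v) ≡ v
fill-toList []       = refl
fill-toList (x ∷ xs) = cong (x ∷_) (fill-toList xs)

toList-fill : ∀ {n} xs → length xs ≡ n → toList (fill {n} xs) ≡ xs
toList-fill []       refl = refl
toList-fill (x ∷ xs) refl = cong (x ∷_) (toList-fill xs refl)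

pushClimb : ∀ {n} → Bool → Climbs (suc n) → Climbs n
pushClimb o (β ∷ βs , σ , t) = βs , climb o β ∷ σ , t

pushSame : ∀ {n} → Climbs n → Climbs n
pushSame (βs , σ , t) = βs , same ∷ σ , t

-- Under flag false, a zero current level marks a `same` step and a positive one a colour-flipping climb.
fromIncrements : ∀ {n} → List Bool → ℕ → List ℕ → Climbs n
fromIncrements []           h       xs       = fill xs , [] , h
fromIncrements (true ∷ fs)  h       xs       = pushClimb false (fromIncrements fs h xs)
fromIncrements (false ∷ fs) (suc h) xs       = pushClimb true (fromIncrements fs h xs)
fromIncrements (false ∷ fs) zero    (x ∷ xs) = pushSame (fromIncrements fs x xs)
fromIncrements (false ∷ fs) zero    []       = fill [] , [] , 0

fromIncrements-toIncrements : ∀ {n} (βs : Vec ℕ n) σ t →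
  let (fs , h , xs) = toIncrements βs σ t in fromIncrements fs h xs ≡ (βs , σ , t)
fromIncrements-toIncrements βs []                  t = cong (_, [] , t) (fill-toList βs)
fromIncrements-toIncrements βs (same ∷ σ)          t = cong pushSame (fromIncrements-toIncrements βs σ t)
fromIncrements-toIncrements βs (climb false β ∷ σ) t = cong (pushClimb false) (fromIncrements-toIncrements (β ∷ βs) σ t)
fromIncrements-toIncrements βs (climb true β ∷ σ)  t = cong (pushClimb true) (fromIncrements-toIncrements (β ∷ βs) σ t)

toIncrements-fromIncrements : ∀ {n} fs h xs → length xs ≡ length fs + n →
  let (βs , σ , t) = fromIncrements {n} fs h xs in toIncrements βs σ t ≡ (fs , h , xs)
toIncrements-fromIncrements []                 h       xs       e = cong (λ ys → [] , h , ys) (toList-fill xs e)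
toIncrements-fromIncrements {n} (true ∷ fs)    h       xs       e
  with fromIncrements {suc n} fs h xs | toIncrements-fromIncrements fs h xs (trans e (sym (+-suc (length fs) n)))
... | β ∷ βs , σ , t | ih = cong overline ih
toIncrements-fromIncrements {n} (false ∷ fs)   (suc h) xs       e
  with fromIncrements {suc n} fs h xs | toIncrements-fromIncrements fs h xs (trans e (sym (+-suc (length fs) n)))
... | β ∷ βs , σ , t | ih = cong raiseLevel ih
toIncrements-fromIncrements (false ∷ fs)       zero    (x ∷ xs) e =
  cong openLevel (toIncrements-fromIncrements fs x xs (suc-injective e))
toIncrements-fromIncrements (false ∷ fs)       zero    []       ()

length-toIncrements-flags : ∀ {n} (βs : Vec ℕ n) σ t → length (proj₁ (toIncrements βs σ t)) ≡ length σ
length-toIncrements-flags βs []                  t = refl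
length-toIncrements-flags βs (same ∷ σ)          t = cong suc (length-toIncrements-flags βs σ t)
length-toIncrements-flags βs (climb false β ∷ σ) t = cong suc (length-toIncrements-flags (β ∷ βs) σ t)
length-toIncrements-flags βs (climb true β ∷ σ)  t = cong suc (length-toIncrements-flags (β ∷ βs) σ t)

length-toIncrements-increments : ∀ {n} (βs : Vec ℕ n) σ t →
  length (proj₂ (proj₂ (toIncrements βs σ t))) ≡ length σ + n
length-toIncrements-increments     βs []                  t = length-toList βs
length-toIncrements-increments     βs (same ∷ σ)          t = cong suc (length-toIncrements-increments βs σ t)
length-toIncrements-increments {n} βs (climb false β ∷ σ) t =
  trans (length-toIncrements-increments (β ∷ βs) σ t) (+-suc (length σ) n)
length-toIncrements-increments {n} βs (climb true β ∷ σ)  t =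
  trans (length-toIncrements-increments (β ∷ βs) σ t) (+-suc (length σ) n)

Balanced-toIncrements : ∀ σ t → Balanced (toIncrements [] σ t)
Balanced-toIncrements σ t =
  trans (length-toIncrements-flags [] σ t) (sym (trans (length-toIncrements-increments [] σ t) (+-identityʳ _)))

incrementsWeight-overline : ∀ p → incrementsWeight (overline p) ≡ suc (length (proj₁ p)) + incrementsWeight p
incrementsWeight-overline (fs , h , xs) rewrite length-map bit fs = arith (length fs) _ _
  where
  arith : ∀ l u v → 1 * suc l + u + v ≡ suc l + (u + v)
  arith = solve-∀

incrementsWeight-raiseLevel : ∀ p →
  incrementsWeight (raiseLevel p) ≡ suc (length (proj₂ (proj₂ p))) + incrementsWeight p
incrementsWeight-raiseLevel (fs , h , xs) = arith (length xs) h _ _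
  where
  arith : ∀ l h u v → u + (suc h * suc l + v) ≡ suc l + (u + (h * suc l + v))
  arith = solve-∀

weight-toIncrements : ∀ {n} (βs : Vec ℕ n) σ t →
  incrementsWeight (toIncrements βs σ t) ≡ weighted (toList βs) + excess n σ t
weight-toIncrements {n} βs [] t rewrite length-toList βs = arith t n (weighted (toList βs))
  where
  arith : ∀ t n w → t * suc n + w ≡ w + suc n * t
  arith = solve-∀
weight-toIncrements βs (same ∷ σ) t = weight-toIncrements βs σ t
weight-toIncrements {n} βs (climb false β ∷ σ) t = begin
  incrementsWeight (overline p)
    ≡⟨ incrementsWeight-overline p ⟩
  suc (length (proj₁ p)) + incrementsWeight p
    ≡⟨ cong₂ (λ l w → suc l + w) (length-toIncrements-flags (β ∷ βs) σ t) (weight-toIncrements (β ∷ βs) σ t) ⟩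
  suc (length σ) + (β * suc (length (toList βs)) + weighted (toList βs) + excess (suc n) σ t)
    ≡⟨ cong (λ l → suc (length σ) + (β * suc l + weighted (toList βs) + excess (suc n) σ t)) (length-toList βs) ⟩
  suc (length σ) + (β * suc n + weighted (toList βs) + excess (suc n) σ t)
    ≡⟨ arith (length σ) β n (weighted (toList βs)) (excess (suc n) σ t) ⟩
  weighted (toList βs) + excess n (climb false β ∷ σ) t ∎
  where
  open ≡-Reasoning
  p = toIncrements (β ∷ βs) σ t
  arith : ∀ l β n w e → suc l + (β * suc n + w + e) ≡ w + (suc l + suc n * β + e)
  arith = solve-∀
weight-toIncrements {n} βs (climb true β ∷ σ) t = begin
  incrementsWeight (raiseLevel p)
    ≡⟨ incrementsWeight-raiseLevel p ⟩
  suc (length (proj₂ (proj₂ p))) + incrementsWeight p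
    ≡⟨ cong₂ (λ l w → suc l + w) (length-toIncrements-increments (β ∷ βs) σ t) (weight-toIncrements (β ∷ βs) σ t) ⟩
  suc (length σ + suc n) + (β * suc (length (toList βs)) + weighted (toList βs) + excess (suc n) σ t)
    ≡⟨ cong (λ l → suc (length σ + suc n) + (β * suc l + weighted (toList βs) + excess (suc n) σ t)) (length-toList βs) ⟩
  suc (length σ + suc n) + (β * suc n + weighted (toList βs) + excess (suc n) σ t)
    ≡⟨ arith (length σ) β n (weighted (toList βs)) (excess (suc n) σ t) ⟩
  weighted (toList βs) + excess n (climb true β ∷ σ) t ∎
  where
  open ≡-Reasoning
  p = toIncrements (β ∷ βs) σ t
  arith : ∀ l β n w e → suc (l + suc n) + (β * suc n + w + e) ≡ w + (suc l + suc n * suc β + e)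
  arith = solve-∀

-- Flagged levels

-- A level d stands for the odd part 2d + 1; the flag records whether that part is overlined.
Flagged : Set
Flagged = ℕ × Bool

levels : List Flagged → List ℕ
levels = map proj₁

-- Consecutive parts of an overpartition listed increasingly: an overlined part exceeds its predecessor.
_◃_ : Flagged → Flagged → Set
(d , _) ◃ (d′ , f) = bit f + d ≤ d′

climbFrom : ℕ → List Bool → List ℕ → List Flagged
climbFrom d (f ∷ fs) (x ∷ xs) = (bit f + d + x , f) ∷ climbFrom (bit f + d + x) fs xs
climbFrom d _        _        = []

ascend : Bool → Increments → List Flagged
ascend g (fs , h , xs) = (h , g) ∷ climbFrom h fs xs

increments : ℕ → List Flagged → List ℕ
increments d []             = []
increments d ((d′ , f) ∷ r) = d′ ∸ (bit f + d) ∷ increments d′ r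

descend : ℕ → List Flagged → Increments
descend d r = map proj₂ r , d , increments d r

climbFrom-Linked : ∀ d g fs xs → Linked _◃_ ((d , g) ∷ climbFrom d fs xs)
climbFrom-Linked d g (f ∷ fs) (x ∷ xs) = m≤m+n (bit f + d) x ∷ climbFrom-Linked _ f fs xs
climbFrom-Linked d g []       _        = [-]
climbFrom-Linked d g (f ∷ fs) []       = [-]

descend-climbFrom : ∀ fs h xs → Balanced (fs , h , xs) → descend h (climbFrom h fs xs) ≡ (fs , h , xs)
descend-climbFrom []       h []       _ = refl
descend-climbFrom (f ∷ fs) h (x ∷ xs) e =
  cong₂ (λ (fs′ , _ , xs′) x′ → f ∷ fs′ , h , x′ ∷ xs′)
        (descend-climbFrom fs (bit f + h + x) xs (suc-injective e)) (m+n∸m≡n (bit f + h) x)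

ascend-descend : ∀ d g r → Linked _◃_ ((d , g) ∷ r) → ascend g (descend d r) ≡ (d , g) ∷ r
ascend-descend d g []             _           = refl
ascend-descend d g ((d′ , f) ∷ r) (d◃d′ ∷ lk) =
  cong ((d , g) ∷_) (trans (cong (λ e → (e , f) ∷ climbFrom e (map proj₂ r) (increments d′ r)) (m+[n∸m]≡n d◃d′))
                           (ascend-descend d′ f r lk))

length-ascend : ∀ g p → Balanced p → length (ascend g p) ≡ suc (length (proj₂ (proj₂ p)))
length-ascend g (fs , h , xs) e = cong suc (length-climbFrom h fs xs e)
  where
  length-climbFrom : ∀ d fs xs → length fs ≡ length xs → length (climbFrom d fs xs) ≡ length xs
  length-climbFrom d []       []       _ = refl
  length-climbFrom d (f ∷ fs) (x ∷ xs) e = cong suc (length-climbFrom _ fs xs (suc-injective e))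

sum-climbFrom : ∀ d fs xs → length fs ≡ length xs →
  sum (levels (climbFrom d fs xs)) ≡ d * length xs + weighted (map bit fs) + weighted xs
sum-climbFrom d []       []       _ = arith d
  where
  arith : ∀ d → 0 ≡ d * 0 + 0 + 0
  arith = solve-∀
sum-climbFrom d (f ∷ fs) (x ∷ xs) e rewrite sum-climbFrom (bit f + d + x) fs xs (suc-injective e)
  | length-map bit fs | suc-injective e = arith d (bit f) x (length xs) (weighted (map bit fs)) (weighted xs)
  where
  arith : ∀ d f x l u v → f + d + x + ((f + d + x) * l + u + v) ≡ d * suc l + (f * suc l + u) + (x * suc l + v)
  arith = solve-∀

sum-ascend : ∀ g p → Balanced p → sum (levels (ascend g p)) ≡ incrementsWeight p
sum-ascend g (fs , h , xs) e rewrite sum-climbFrom h fs xs e = arith h (length xs) (weighted (map bit fs)) (weighted xs)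
  where
  arith : ∀ h l u v → h + (h * l + u + v) ≡ u + (h * suc l + v)
  arith = solve-∀

length-increments : ∀ d r → length (increments d r) ≡ length r
length-increments d []            = refl
length-increments d ((_ , _) ∷ r) = cong suc (length-increments _ r)

-- Overlined and ordinary parts

split : List Flagged → List ℕ × List ℕ
split []                = [] , []
split ((d , true)  ∷ r) = map₁ (d ∷_) (split r)
split ((d , false) ∷ r) = map₂ (d ∷_) (split r)

mutual
  merge : List ℕ → List ℕ → List Flagged
  merge []       []       = []
  merge []       (y ∷ ys) = (y , false) ∷ merge [] ys
  merge (x ∷ xs) ys       = mergeFrom x xs ys

  mergeFrom : ℕ → List ℕ → List ℕ → List Flagged
  mergeFrom x xs []           = (x , true) ∷ merge xs []
  mergeFrom x xs ys@(y ∷ ys′) with x ≤? y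
  ... | yes _ = (x , true) ∷ merge xs ys
  ... | no _  = (y , false) ∷ mergeFrom x xs ys′

mutual
  split-merge : ∀ xs ys → split (merge xs ys) ≡ (xs , ys)
  split-merge []       []       = refl
  split-merge []       (y ∷ ys) = cong (map₂ (y ∷_)) (split-merge [] ys)
  split-merge (x ∷ xs) ys       = split-mergeFrom x xs ys

  split-mergeFrom : ∀ x xs ys → split (mergeFrom x xs ys) ≡ (x ∷ xs , ys)
  split-mergeFrom x xs []           = cong (map₁ (x ∷_)) (split-merge xs [])
  split-mergeFrom x xs ys@(y ∷ ys′) with x ≤? y
  ... | yes _ = cong (map₁ (x ∷_)) (split-merge xs ys)
  ... | no _  = cong (map₂ (y ∷_)) (split-mergeFrom x xs ys′)

◃-split : ∀ {d g r} → Linked _◃_ ((d , g) ∷ r) →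
  Linked _<_ (d ∷ proj₁ (split r)) × Linked _≤_ (d ∷ proj₂ (split r))
◃-split {r = []}               _           = [-] , [-]
◃-split {r = (d′ , true) ∷ r}  (d<d′ ∷ lk) =
  d<d′ ∷ proj₁ (◃-split lk) , Linked-weakenHead (≤-trans (<⇒≤ d<d′)) (proj₂ (◃-split lk))
◃-split {r = (d′ , false) ∷ r} (d≤d′ ∷ lk) =
  Linked-weakenHead (≤-<-trans d≤d′) (proj₁ (◃-split lk)) , d≤d′ ∷ proj₂ (◃-split lk)

split-Linked : ∀ L → Linked _◃_ L → Linked _<_ (proj₁ (split L)) × Linked _≤_ (proj₂ (split L))
split-Linked []                _  = [] , []
split-Linked ((d , true)  ∷ r) lk = proj₁ (◃-split lk) , Linked.tail (proj₂ (◃-split lk))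
split-Linked ((d , false) ∷ r) lk = Linked.tail (proj₁ (◃-split lk)) , proj₂ (◃-split lk)

merge-overlined : ∀ {x} xs ys → Linked _≤_ (x ∷ ys) → merge (x ∷ xs) ys ≡ (x , true) ∷ merge xs ys
merge-overlined     xs []       _         = refl
merge-overlined {x} xs (y ∷ ys) (x≤y ∷ _) with x ≤? y
... | yes _   = refl
... | no x≰y = ⊥-elim (x≰y x≤y)

merge-ordinary : ∀ {y} xs ys → Linked _<_ (y ∷ xs) → merge xs (y ∷ ys) ≡ (y , false) ∷ merge xs ys
merge-ordinary     []       ys _         = refl
merge-ordinary {y} (x ∷ xs) ys (y<x ∷ _) with x ≤? y
... | yes x≤y = ⊥-elim (<⇒≱ y<x x≤y)
... | no _    = refl

merge-split : ∀ L → Linked _◃_ L → merge (proj₁ (split L)) (proj₂ (split L)) ≡ L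
merge-split []                _  = refl
merge-split ((d , true)  ∷ r) lk =
  trans (merge-overlined _ _ (proj₂ (◃-split lk))) (cong ((d , true) ∷_) (merge-split r (Linked.tail lk)))
merge-split ((d , false) ∷ r) lk =
  trans (merge-ordinary _ _ (proj₁ (◃-split lk))) (cong ((d , false) ∷_) (merge-split r (Linked.tail lk)))

mutual
  ◃-merge : ∀ {d g xs ys} → Linked _<_ (d ∷ xs) → Linked _≤_ (d ∷ ys) → Linked _◃_ ((d , g) ∷ merge xs ys)
  ◃-merge {xs = []}    {[]}     _          _          = [-]
  ◃-merge {xs = []}    {y ∷ ys} _          (d≤y ∷ ly) = d≤y ∷ ◃-merge [-] ly
  ◃-merge {xs = _ ∷ _}          (d<x ∷ lx) ly         = ◃-mergeFrom d<x lx ly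

  ◃-mergeFrom : ∀ {d g x xs ys} → d < x → Linked _<_ (x ∷ xs) → Linked _≤_ (d ∷ ys) →
    Linked _◃_ ((d , g) ∷ mergeFrom x xs ys)
  ◃-mergeFrom {ys = []}            d<x lx _          = d<x ∷ ◃-merge lx [-]
  ◃-mergeFrom {x = x} {ys = y ∷ _} d<x lx (d≤y ∷ ly) with x ≤? y
  ... | yes x≤y = d<x ∷ ◃-merge lx (x≤y ∷ ly)
  ... | no x≰y  = d≤y ∷ ◃-mergeFrom (≰⇒> x≰y) lx ly

merge-Linked : ∀ {xs ys} → Linked _<_ xs → Linked _≤_ ys → Linked _◃_ (merge xs ys)
merge-Linked {[]}     {[]}         _  _  = []
merge-Linked {[]}     {y ∷ ys}     _  ly = ◃-merge [-] ly
merge-Linked {x ∷ xs} {[]}         lx _  = ◃-merge lx [-]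
merge-Linked {x ∷ xs} {ys@(y ∷ _)} lx ly with x ≤? y
... | yes x≤y = ◃-merge lx (x≤y ∷ ly)
... | no x≰y  = ◃-mergeFrom (≰⇒> x≰y) lx ly

sum-split : ∀ L → sum (proj₁ (split L)) + sum (proj₂ (split L)) ≡ sum (levels L)
sum-split []                = refl
sum-split ((d , true)  ∷ r) = trans (+-assoc d _ _) (cong (d +_) (sum-split r))
sum-split ((d , false) ∷ r) =
  trans (x+[d+y]≡d+[x+y] (sum (proj₁ (split r))) d (sum (proj₂ (split r)))) (cong (d +_) (sum-split r))
  where
  x+[d+y]≡d+[x+y] : ∀ x d y → x + (d + y) ≡ d + (x + y)
  x+[d+y]≡d+[x+y] = solve-∀

length-split : ∀ L → length (proj₁ (split L)) + length (proj₂ (split L)) ≡ length L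
length-split []                = refl
length-split ((d , true)  ∷ r) = cong suc (length-split r)
length-split ((d , false) ∷ r) = trans (+-suc (length (proj₁ (split r))) _) (cong suc (length-split r))

halve-oddPart : ∀ d → ⌊ oddPart d /2⌋ ≡ d
halve-oddPart zero    = refl
halve-oddPart (suc d) = cong suc (halve-oddPart d)

oddPart-halve : ∀ x → isOdd x → oddPart ⌊ x /2⌋ ≡ x
oddPart-halve (suc zero)    _ = refl
oddPart-halve (suc (suc x)) p = cong (suc ∘ suc) (oddPart-halve x p)

oddPart-mono-< : ∀ {d e} → d < e → oddPart d < oddPart e
oddPart-mono-< d<e = s≤s (*-monoˡ-< 2 d<e)

oddPart-mono-≤ : ∀ {d e} → d ≤ e → oddPart d ≤ oddPart e
oddPart-mono-≤ d≤e = s≤s (*-monoˡ-≤ 2 d≤e)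

oddPart-cancel-< : ∀ {d e} → oddPart d < oddPart e → d < e
oddPart-cancel-< {d} {e} (s≤s lt) = *-cancelʳ-< 2 d e lt

oddPart-cancel-≤ : ∀ {d e} → oddPart d ≤ oddPart e → d ≤ e
oddPart-cancel-≤ {d} {e} (s≤s le) = *-cancelʳ-≤ d e 2 le

toParts : List ℕ → List ℕ
toParts ds = reverse (map oddPart ds)

toLevels : List ℕ → List ℕ
toLevels xs = reverse (map ⌊_/2⌋ xs)

map-halve-oddPart : ∀ ds → map ⌊_/2⌋ (map oddPart ds) ≡ ds
map-halve-oddPart []       = refl
map-halve-oddPart (d ∷ ds) = cong₂ _∷_ (halve-oddPart d) (map-halve-oddPart ds)

map-oddPart-halve : ∀ {xs} → All isOdd xs → map oddPart (map ⌊_/2⌋ xs) ≡ xs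
map-oddPart-halve []       = refl
map-oddPart-halve (p ∷ ps) = cong₂ _∷_ (oddPart-halve _ p) (map-oddPart-halve ps)

toLevels-toParts : ∀ ds → toLevels (toParts ds) ≡ ds
toLevels-toParts ds = begin
  reverse (map ⌊_/2⌋ (reverse (map oddPart ds))) ≡⟨ cong reverse (reverse-map ⌊_/2⌋ (map oddPart ds)) ⟩
  reverse (reverse (map ⌊_/2⌋ (map oddPart ds))) ≡⟨ reverse-involutive _ ⟩
  map ⌊_/2⌋ (map oddPart ds)                     ≡⟨ map-halve-oddPart ds ⟩
  ds                                             ∎
  where open ≡-Reasoning

toParts-toLevels : ∀ {xs} → All isOdd xs → toParts (toLevels xs) ≡ xs
toParts-toLevels {xs} odd = begin
  reverse (map oddPart (reverse (map ⌊_/2⌋ xs))) ≡⟨ cong reverse (reverse-map oddPart (map ⌊_/2⌋ xs)) ⟩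
  reverse (reverse (map oddPart (map ⌊_/2⌋ xs))) ≡⟨ reverse-involutive _ ⟩
  map oddPart (map ⌊_/2⌋ xs)                     ≡⟨ map-oddPart-halve odd ⟩
  xs                                             ∎
  where open ≡-Reasoning

toParts-Linked : ∀ {R : ℕ → ℕ → Set} → (∀ {d e} → R d e → R (oddPart d) (oddPart e)) →
  ∀ {ds} → Linked R ds → Linked (flip R) (toParts ds)
toParts-Linked mono lk = Linked-reverse (Linked.map⁺ (Linked.map mono lk))

toLevels-Linked : ∀ {R : ℕ → ℕ → Set} → (∀ {d e} → R (oddPart d) (oddPart e) → R d e) →
  ∀ {xs} → All isOdd xs → Linked (flip R) xs → Linked R (toLevels xs)
toLevels-Linked cancel odd lk =
  Linked-reverse (Linked.map cancel (Linked.map⁻ (subst (Linked _) (sym (map-oddPart-halve odd)) lk)))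

toParts-isOdd : ∀ ds → All isOdd (toParts ds)
toParts-isOdd ds = All-resp-↭ (↭-sym (↭-reverse _)) (All.map⁺ (universal oddPart-isOdd ds))

length-toParts : ∀ ds → length (toParts ds) ≡ length ds
length-toParts ds = trans (length-reverse (map oddPart ds)) (length-map oddPart ds)

sum-toParts : ∀ ds → sum (toParts ds) ≡ length ds + 2 * sum ds
sum-toParts ds = trans (sum-↭ (↭-reverse (map oddPart ds))) (sum-map-oddPart ds)
  where
  sum-map-oddPart : ∀ ds → sum (map oddPart ds) ≡ length ds + 2 * sum ds
  sum-map-oddPart []       = refl
  sum-map-oddPart (d ∷ ds) rewrite sum-map-oddPart ds = arith d (length ds) (sum ds)
    where
    arith : ∀ d l s → suc (d * 2) + (l + 2 * s) ≡ suc (l + 2 * (d + s))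
    arith = solve-∀

-- The bijection

encode : Bool → List Colour → List Flagged
encode s w = ascend s (toIncrements [] (proj₁ (steps s w)) (proj₂ (steps s w)))

flagged : List Colour → List Flagged
flagged []      = []
flagged (a ∷ w) = encode false w
flagged (b ∷ w) = []
flagged (c ∷ w) = encode true w

flagged-colour : ∀ s w → flagged (colour s ∷ w) ≡ encode s w
flagged-colour false w = refl
flagged-colour true  w = refl

decode : List Flagged → List Colour
decode []            = []
decode ((d , g) ∷ r) =
  let (fs , h , xs) = descend d r
      (_ , σ , t)   = fromIncrements {0} fs h xs
  in colour g ∷ word g σ t

GroundedWord-decode : ∀ L → GroundedWord (decode L)
GroundedWord-decode []            = []
GroundedWord-decode ((d , g) ∷ r) = g ∷ _

flagged-Linked : ∀ w → Linked _◃_ (flagged w)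
flagged-Linked []      = []
flagged-Linked (a ∷ w) = climbFrom-Linked _ false _ _
flagged-Linked (b ∷ w) = []
flagged-Linked (c ∷ w) = climbFrom-Linked _ true _ _

decode-encode : ∀ s w → decode (encode s w) ≡ colour s ∷ w
decode-encode s w = begin
  decode (ascend s (toIncrements [] σ t))
    ≡⟨ cong (λ (fs , h , xs) → let (_ , σ′ , t′) = fromIncrements {0} fs h xs in colour s ∷ word s σ′ t′)
            (descend-climbFrom fs h xs (Balanced-toIncrements σ t)) ⟩
  colour s ∷ word s (proj₁ (proj₂ (fromIncrements {0} fs h xs))) (proj₂ (proj₂ (fromIncrements {0} fs h xs)))
    ≡⟨ cong (λ (_ , σ′ , t′) → colour s ∷ word s σ′ t′) (fromIncrements-toIncrements [] σ t) ⟩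
  colour s ∷ word s σ t
    ≡⟨ cong (colour s ∷_) (word-steps s w) ⟩
  colour s ∷ w ∎
  where
  open ≡-Reasoning
  σ = proj₁ (steps s w)
  t = proj₂ (steps s w)
  fs = proj₁ (toIncrements [] σ t)
  h = proj₁ (proj₂ (toIncrements [] σ t))
  xs = proj₂ (proj₂ (toIncrements [] σ t))

decode-flagged : ∀ {w} → GroundedWord w → decode (flagged w) ≡ w
decode-flagged []      = refl
decode-flagged (s ∷ w) = trans (cong decode (flagged-colour s w)) (decode-encode s w)

flagged-decode : ∀ L → Linked _◃_ L → flagged (decode L) ≡ L
flagged-decode []            _  = refl
flagged-decode ((d , g) ∷ r) lk = begin
  flagged (colour g ∷ word g σ t)
    ≡⟨ flagged-colour g (word g σ t) ⟩
  ascend g (toIncrements [] (proj₁ (steps g (word g σ t))) (proj₂ (steps g (word g σ t))))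
    ≡⟨ cong (λ (σ′ , t′) → ascend g (toIncrements [] σ′ t′)) (steps-word g σ t) ⟩
  ascend g (toIncrements [] σ t)
    ≡⟨ cong (λ βs′ → ascend g (toIncrements βs′ σ t)) (Vec₀-[] βs) ⟩
  ascend g (toIncrements βs σ t)
    ≡⟨ cong (ascend g) (toIncrements-fromIncrements (map proj₂ r) d (increments d r) lengths) ⟩
  ascend g (descend d r)
    ≡⟨ ascend-descend d g r lk ⟩
  (d , g) ∷ r ∎
  where
  open ≡-Reasoning
  βs = proj₁ (fromIncrements {0} (map proj₂ r) d (increments d r))
  σ = proj₁ (proj₂ (fromIncrements {0} (map proj₂ r) d (increments d r)))
  t = proj₂ (proj₂ (fromIncrements {0} (map proj₂ r) d (increments d r)))
  Vec₀-[] : (v : Vec ℕ 0) → [] ≡ v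
  Vec₀-[] [] = refl
  lengths : length (increments d r) ≡ length (map proj₂ r) + 0
  lengths = trans (length-increments d r) (sym (trans (+-identityʳ _) (length-map proj₂ r)))

length-encode : ∀ s w → length (encode s w) ≡ suc (length (proj₁ (steps s w)))
length-encode s w = trans (length-ascend s (toIncrements [] σ t) (Balanced-toIncrements σ t))
                          (cong suc (trans (length-toIncrements-increments [] σ t) (+-identityʳ _)))
  where
  σ = proj₁ (steps s w)
  t = proj₂ (steps s w)

sum-encode : ∀ s w → sum (levels (encode s w)) ≡ excess 0 (proj₁ (steps s w)) (proj₂ (steps s w))
sum-encode s w = trans (sum-ascend s (toIncrements [] σ t) (Balanced-toIncrements σ t)) (weight-toIncrements [] σ t)
  where
  σ = proj₁ (steps s w)
  t = proj₂ (steps s w)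

weight-flagged : ∀ {w} → GroundedWord w →
  sum (sizes (partsOf w)) ≡ length (flagged w) + 2 * sum (levels (flagged w))
weight-flagged []      = refl
weight-flagged (s ∷ w) = begin
  sum (sizes (partsOf (colour s ∷ w)))
    ≡⟨ cong (λ w′ → sum (sizes (partsOf (colour s ∷ w′)))) (sym (word-steps s w)) ⟩
  sum (sizes (partsOf (colour s ∷ word s σ t)))
    ≡⟨ cong sum (sizes-partsOf s (word s σ t)) ⟩
  1 + sum (sizes (partsFrom 1 (colour s) (word s σ t)))
    ≡⟨ cong (1 +_) (sum-word 0 s σ t) ⟩
  1 + (1 * length σ + 2 * excess 0 σ t)
    ≡⟨ cong (λ l → 1 + (l + 2 * excess 0 σ t)) (*-identityˡ (length σ)) ⟩
  suc (length σ) + 2 * excess 0 σ t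
    ≡⟨ sym (cong₂ (λ l e → l + 2 * e) (length-encode s w) (sum-encode s w)) ⟩
  length (encode s w) + 2 * sum (levels (encode s w))
    ≡⟨ cong (λ L → length L + 2 * sum (levels L)) (sym (flagged-colour s w)) ⟩
  length (flagged (colour s ∷ w)) + 2 * sum (levels (flagged (colour s ∷ w))) ∎
  where
  open ≡-Reasoning
  σ = proj₁ (steps s w)
  t = proj₂ (steps s w)

oddCount-flagged : ∀ {w} → GroundedWord w → oddCount (sizes (partsOf w)) ≡ length (flagged w)
oddCount-flagged []      = refl
oddCount-flagged (s ∷ w) = begin
  oddCount (sizes (partsOf (colour s ∷ w)))
    ≡⟨ cong (λ w′ → oddCount (sizes (partsOf (colour s ∷ w′)))) (sym (word-steps s w)) ⟩
  oddCount (sizes (partsOf (colour s ∷ word s σ t)))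
    ≡⟨ cong oddCount (sizes-partsOf s (word s σ t)) ⟩
  oddCount (1 ∷ sizes (partsFrom 1 (colour s) (word s σ t)))
    ≡⟨ oddCount-odd 1 (sizes (partsFrom 1 (colour s) (word s σ t))) refl ⟩
  suc (oddCount (sizes (partsFrom 1 (colour s) (word s σ t))))
    ≡⟨ cong suc (oddCount-word 0 s σ t) ⟩
  suc (length σ)
    ≡⟨ sym (length-encode s w) ⟩
  length (encode s w)
    ≡⟨ cong length (sym (flagged-colour s w)) ⟩
  length (flagged (colour s ∷ w)) ∎
  where
  open ≡-Reasoning
  σ = proj₁ (steps s w)
  t = proj₂ (steps s w)

totalWeight : List ℕ × List ℕ → ℕ
totalWeight (X , Y) = sum X + sum Y

totalLength : List ℕ × List ℕ → ℕ
totalLength (X , Y) = length X + length Y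

IsOddOverpartition : List ℕ × List ℕ → Set
IsOddOverpartition (X , Y) = Linked _>_ X × Linked _≥_ Y × All isOdd X × All isOdd Y

halves : List Flagged → List ℕ × List ℕ
halves L = toParts (proj₁ (split L)) , toParts (proj₂ (split L))

weight-halves : ∀ L → totalWeight (halves L) ≡ length L + 2 * sum (levels L)
weight-halves L = begin
  sum (toParts X) + sum (toParts Y)               ≡⟨ cong₂ _+_ (sum-toParts X) (sum-toParts Y) ⟩
  (length X + 2 * sum X) + (length Y + 2 * sum Y) ≡⟨ arith (length X) (sum X) (length Y) (sum Y) ⟩
  (length X + length Y) + 2 * (sum X + sum Y)     ≡⟨ cong₂ (λ l s → l + 2 * s) (length-split L) (sum-split L) ⟩
  length L + 2 * sum (levels L)                   ∎
  where
  open ≡-Reasoning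
  X = proj₁ (split L)
  Y = proj₂ (split L)
  arith : ∀ a b c d → (a + 2 * b) + (c + 2 * d) ≡ (a + c) + 2 * (b + d)
  arith = solve-∀

length-halves : ∀ L → totalLength (halves L) ≡ length L
length-halves L = trans (cong₂ _+_ (length-toParts (proj₁ (split L))) (length-toParts (proj₂ (split L)))) (length-split L)

halves-valid : ∀ L → Linked _◃_ L → IsOddOverpartition (halves L)
halves-valid L lk =
  toParts-Linked oddPart-mono-< (proj₁ (split-Linked L lk)) , toParts-Linked oddPart-mono-≤ (proj₂ (split-Linked L lk)) ,
  toParts-isOdd (proj₁ (split L)) , toParts-isOdd (proj₂ (split L))

overpartitionOf : List CPart → List ℕ × List ℕ
overpartitionOf ps = halves (flagged (colours ps))

partitionOf : List ℕ × List ℕ → List CPart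
partitionOf (X , Y) = partsOf (decode (merge (toLevels X) (toLevels Y)))

overpartitionOf-valid : ∀ ps → IsOddOverpartition (overpartitionOf ps)
overpartitionOf-valid ps = halves-valid (flagged (colours ps)) (flagged-Linked (colours ps))

partitionOf-grounded : ∀ XY → IsGrounded (partitionOf XY)
partitionOf-grounded (X , Y) = partsOf-grounded (GroundedWord-decode (merge (toLevels X) (toLevels Y)))

partitionOf-overpartitionOf : ∀ ps → IsGrounded ps → partitionOf (overpartitionOf ps) ≡ ps
partitionOf-overpartitionOf ps grounded = begin
  partsOf (decode (merge (toLevels (toParts X)) (toLevels (toParts Y))))
    ≡⟨ cong₂ (λ X′ Y′ → partsOf (decode (merge X′ Y′))) (toLevels-toParts X) (toLevels-toParts Y) ⟩
  partsOf (decode (merge X Y))         ≡⟨ cong (partsOf ∘ decode) (merge-split L (flagged-Linked (colours ps))) ⟩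
  partsOf (decode L)                   ≡⟨ cong partsOf (decode-flagged (GroundedWord-colours ps grounded)) ⟩
  partsOf (colours ps)                 ≡⟨ partsFrom-colours 0 b ps grounded ⟩
  ps                                   ∎
  where
  open ≡-Reasoning
  L = flagged (colours ps)
  X = proj₁ (split L)
  Y = proj₂ (split L)

overpartitionOf-partitionOf : ∀ {X Y} → IsOddOverpartition (X , Y) → overpartitionOf (partitionOf (X , Y)) ≡ (X , Y)
overpartitionOf-partitionOf {X} {Y} (lx , ly , ox , oy) = begin
  halves (flagged (colours (partsOf (decode L))))  ≡⟨ cong (halves ∘ flagged) (colours-partsFrom 0 b (decode L)) ⟩
  halves (flagged (decode L))                     ≡⟨ cong halves (flagged-decode L lk) ⟩
  halves L
    ≡⟨ cong (λ (X′ , Y′) → toParts X′ , toParts Y′) (split-merge (toLevels X) (toLevels Y)) ⟩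
  toParts (toLevels X) , toParts (toLevels Y)     ≡⟨ cong₂ _,_ (toParts-toLevels ox) (toParts-toLevels oy) ⟩
  X , Y                                           ∎
  where
  open ≡-Reasoning
  L = merge (toLevels X) (toLevels Y)
  lk = merge-Linked (toLevels-Linked oddPart-cancel-< ox lx) (toLevels-Linked oddPart-cancel-≤ oy ly)

weight-overpartitionOf : ∀ ps → IsGrounded ps → totalWeight (overpartitionOf ps) ≡ sum (sizes ps)
weight-overpartitionOf ps grounded =
  trans (weight-halves (flagged (colours ps)))
        (trans (sym (weight-flagged (GroundedWord-colours ps grounded)))
               (cong (sum ∘ sizes) (partsFrom-colours 0 b ps grounded)))

length-overpartitionOf : ∀ ps → IsGrounded ps → totalLength (overpartitionOf ps) ≡ oddCount (sizes ps)
length-overpartitionOf ps grounded =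
  trans (length-halves (flagged (colours ps)))
        (trans (sym (oddCount-flagged (GroundedWord-colours ps grounded)))
               (cong (oddCount ∘ sizes) (partsFrom-colours 0 b ps grounded)))

weight-partitionOf : ∀ {XY} → IsOddOverpartition XY → sum (sizes (partitionOf XY)) ≡ totalWeight XY
weight-partitionOf {XY} valid =
  trans (sym (weight-overpartitionOf _ (partitionOf-grounded XY))) (cong totalWeight (overpartitionOf-partitionOf valid))

oddCount-partitionOf : ∀ {XY} → IsOddOverpartition XY → oddCount (sizes (partitionOf XY)) ≡ totalLength XY
oddCount-partitionOf {XY} valid =
  trans (sym (length-overpartitionOf _ (partitionOf-grounded XY))) (cong totalLength (overpartitionOf-partitionOf valid))

_≟ᶜ_ : DecidableEquality Colour
a ≟ᶜ a = yes refl
a ≟ᶜ b = no λ ()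
a ≟ᶜ c = no λ ()
b ≟ᶜ a = no λ ()
b ≟ᶜ b = yes refl
b ≟ᶜ c = no λ ()
c ≟ᶜ a = no λ ()
c ≟ᶜ b = no λ ()
c ≟ᶜ c = yes refl

Pb-≡ : ∀ {n k} {p q : Pb n k} → Pb.parts p ≡ Pb.parts q → p ≡ q
Pb-≡ {p = mkPb _ _ _ _} {mkPb _ _ _ _} refl = refl

POb-≡ : ∀ {n k} {p q : POb n k} → POb.overlined p ≡ POb.overlined q → POb.ordinary p ≡ POb.ordinary q → p ≡ q
POb-≡ {p = mkPOb _ _ _ _ _ _ _ _} {mkPOb _ _ _ _ _ _ _ _} refl refl = refl

-- The round-trip equations hold only under the irrelevant validity fields, so they are recomputed
-- from decidable equality.
module _ {n k : ℕ} where

  toPOb : Pb n k → POb n k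
  toPOb (mkPb ps grounded weight odds) =
    let (lx , ly , ox , oy) = overpartitionOf-valid ps
    in mkPOb (proj₁ (overpartitionOf ps)) (proj₂ (overpartitionOf ps)) lx ly ox oy
             (trans (weight-overpartitionOf ps grounded) weight) (trans (length-overpartitionOf ps grounded) odds)

  fromPOb : POb n k → Pb n k
  fromPOb (mkPOb X Y lx ly ox oy weight count) =
    mkPb (partitionOf (X , Y)) (partitionOf-grounded (X , Y))
         (trans (weight-partitionOf (lx , ly , ox , oy)) weight) (trans (oddCount-partitionOf (lx , ly , ox , oy)) count)

  toPOb-fromPOb : ∀ p → toPOb (fromPOb p) ≡ p
  toPOb-fromPOb (mkPOb X Y lx ly ox oy _ _) =
    POb-≡ (recompute (List.≡-dec _≟_ _ _) (cong proj₁ (overpartitionOf-partitionOf (lx , ly , ox , oy))))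
          (recompute (List.≡-dec _≟_ _ _) (cong proj₂ (overpartitionOf-partitionOf (lx , ly , ox , oy))))

  fromPOb-toPOb : ∀ p → fromPOb (toPOb p) ≡ p
  fromPOb-toPOb (mkPb ps grounded _ _) =
    Pb-≡ (recompute (List.≡-dec (≡-dec _≟_ _≟ᶜ_) _ _) (partitionOf-overpartitionOf ps grounded))

theorem1p14 : (n k : ℕ) → k ≤ n → Pb n k ↔ POb n k
theorem1p14 n k _ = mk↔ₛ′ toPOb fromPOb toPOb-fromPOb fromPOb-toPOb
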